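{- Let $G$ be a finite connected graph and let $R$ be a USP-relation on $E(G)$. Then the partition $\mathcal P^R=\{V_R(x)\mid x\in V(G)\}$ of $V(G)$, where $V_R(x)=\bigcap_{\varphi} V(G^x_{\overline\varphi})$ with the intersection over all $R$-classes $\varphi$, is an equitable partition of $G$.
   Context: $G$ is a finite connected simple graph. For a set $\varphi\subseteq E(G)$, $G_\varphi$ denotes the spanning subgraph with vertex set $V(G)$ and edge set $\varphi$, $G_\varphi^x$ denotes the connected component of $G_\varphi$ containing the vertex $x$, and $\overline\varphi=E(G)\setminus\varphi$. A chordless square is an induced cycle on four vertices. An equivalence relation $Q$ on $E(G)$ has the unique square property if any two adjacent edges $e,f$ lying in distinct $Q$-classes are contained in exactly one chordless square whose opposite edges lie in the same $Q$-class. An equivalence relation $R$ on $E(G)$ is a USP-relation if there exists an equivalence relation $Q\subseteq R$ (i.e. $Q$ is finer than $R$) with the unique square property. A partition $\mathcal P$ of $V(G)$ is equitable if for all (not necessarily distinct) classes $A,B\in\mathcal P$, every vertex $x\in A$ has the same number $|N_G(x)\cap B|$ of neighbours in $B$. -}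

module Defs where

open import Data.Nat using (ℕ)
open import Data.Bool using (Bool; true; false; T)
open import Data.Fin using (Fin; _<_)
open import Data.Fin.Properties using (<-cmp)
open import Data.Product using (Σ; _×_; _,_; ∃)
open import Data.List using (length; filter; allFin)
open import Data.Empty using (⊥)
open import Relation.Nullary using (¬_)
open import Relation.Unary using (Decidable)
open import Relation.Binary using (IsEquivalence; tri<; tri≈; tri>)
open import Relation.Binary.PropositionalEquality using (_≡_; _≢_; refl; subst; sym)

record Graph (n : ℕ) : Set where
  field
    adj     : Fin n → Fin n → Bool
    adj-sym : ∀ x y → adj x y ≡ adj y x
    loopless : ∀ x → adj x x ≡ false

module _ {n : ℕ} (G : Graph n) where
  open Graph G

  Adj : Fin n → Fin n → Set
  Adj x y = T (adj x y)

  -- An edge {x,y} is stored canonically as the ordered pair with x < y.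
  Edge : Set
  Edge = Σ (Fin n × Fin n) λ p → (Data.Product.proj₁ p < Data.Product.proj₂ p) × Adj (Data.Product.proj₁ p) (Data.Product.proj₂ p)

  private
    noLoop : ∀ x → Adj x x → ⊥
    noLoop x a = subst T (loopless x) a

  edge : ∀ {x y} → Adj x y → Edge
  edge {x} {y} a with <-cmp x y
  ... | tri< lt _ _ = (x , y) , lt , a
  ... | tri≈ _ refl _ = Data.Empty.⊥-elim (noLoop x a)
  ... | tri> _ _ gt = (y , x) , gt , subst T (adj-sym x y) a

  EdgeRel : Set₁
  EdgeRel = Edge → Edge → Set

  -- Reach φ x y : y lies in the component of x in the spanning subgraph with
  -- edge set E(G) \ φ  (i.e. there is a walk from x to y avoiding φ).
  data Reach (φ : Edge → Set) : Fin n → Fin n → Set where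
    here : ∀ {x} → Reach φ x x
    step : ∀ {x y z} (a : Adj x y) → ¬ φ (edge a) → Reach φ y z → Reach φ x z

  Connected : Set
  Connected = ∀ x y → Reach (λ _ → ⊥) x y

  record ChordlessSquare (x y w z : Fin n) : Set where
    field
      xy : Adj x y
      yw : Adj y w
      wz : Adj w z
      zx : Adj z x
      x≢w : x ≢ w
      y≢z : y ≢ z
      noChord-xw : ¬ Adj x w
      noChord-yz : ¬ Adj y z

  -- Unique square property: any two adjacent (distinct) edges xy, xz in distinct
  -- Q-classes lie in exactly one chordless square x y w z whose opposite edges
  -- are Q-related (xy ~ wz and xz ~ yw).  Such a square is determined by w.
  SquareWith : EdgeRel → ∀ {x y z} → Adj x y → Adj x z → Fin n → Set
  SquareWith Q {x} {y} {z} a b w =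
    Σ (ChordlessSquare x y w z) λ s →
      Q (edge a) (edge (ChordlessSquare.wz s)) × Q (edge b) (edge (ChordlessSquare.yw s))

  UniqueSquareProperty : EdgeRel → Set
  UniqueSquareProperty Q =
    ∀ {x y z} (a : Adj x y) (b : Adj x z) → y ≢ z → ¬ Q (edge a) (edge b) →
      Σ (Fin n) λ w → SquareWith Q a b w × (∀ w' → SquareWith Q a b w' → w' ≡ w)

  IsUSPRelation : EdgeRel → Set₁
  IsUSPRelation R =
    Σ EdgeRel λ Q → IsEquivalence Q × UniqueSquareProperty Q × (∀ e f → Q e f → R e f)

  -- V_R(x) = ⋂_{φ R-class} V(G^x_{φ̄}); R-classes are indexed by representatives e,
  -- φ = {f | R e f}.  VR R x y means y ∈ V_R(x).
  VR : EdgeRel → Fin n → Fin n → Set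
  VR R x y = ∀ (e : Edge) → Reach (R e) x y

count : ∀ {n} {P : Fin n → Set} → Decidable P → ℕ
count {n} d = length (filter d (allFin n))

-- Let Q ⊆ R have the unique square property and let φ be a union of Q-classes.
-- If uv ∉ φ and uy ∈ φ, the USP yields a unique chordless square u y w v whose
-- opposite sides are Q-related, so vw ∈ φ and yw ∉ φ: the φ-edge uy is
-- translated across uv to the φ-edge vw.  Seen from v the same square is the
-- unique one for vu and vw, so y is recovered from w.  Iterating along a walk
-- from u to v avoiding φ gives an injective translation of the φ-edges at u to
-- φ-edges at v (module Squares).
--
-- For x' ∈ V_R(x) and a neighbour y of x, take φ = the R-class of xy and
-- translate xy along the walk from x to x' avoiding φ; the walk is fixed by a
-- canonical representative of the class, so that neighbours in one class use
-- the same walk.  This maps the neighbours of x in V_R(z) injectively to the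
-- neighbours of x' in V_R(z) (module Equitable), hence the counts agree by
-- symmetry.  The argument decides R-membership; since the inequality of counts
-- is decidable, R may be assumed decidable classically.
module Submission where

open import Defs

open import Data.Bool using (T)
open import Data.Bool.Properties using (T-irrelevant; T?)
open import Data.Empty using (⊥-elim)
open import Data.Fin using (Fin; zero; suc)
open import Data.Fin.Properties using (<-cmp; <-irrelevant; <-asym; injective⇒≤)
open import Data.List using (List; _∷_; length; filter; allFin; lookup)
open import Data.List.Membership.Propositional using (_∈_)
open import Data.List.Membership.Propositional.Properties
  using (∈-filter⁺; ∈-filter⁻; ∈-allFin; ∈-lookup)
open import Data.List.Membership.Setoid.Properties as SetoidMembership using ()
open import Data.List.Relation.Unary.Any as Any using (Any; here; there)
open import Data.List.Relation.Unary.All as All using ()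
open import Data.List.Relation.Unary.AllPairs using (_∷_)
open import Data.List.Relation.Unary.Unique.Propositional using (Unique)
open import Data.List.Relation.Unary.Unique.Propositional.Properties using (filter⁺; allFin⁺)
open import Data.Nat using (ℕ; _≤_; _≤?_)
open import Data.Nat.Properties using (≤-antisym)
open import Data.Product using (Σ; _×_; _,_; proj₁; proj₂)
open import Relation.Binary using (IsEquivalence; tri<; tri≈; tri>)
open import Relation.Binary.PropositionalEquality
open import Relation.Nullary using (¬_; Dec; yes; no)
open import Relation.Nullary.Decidable using (decidable-stable; ¬¬-excluded-middle)
open import Relation.Nullary.Negation using (¬¬-map)
open import Relation.Unary using (Decidable; _≐_)

module GraphFacts {n : ℕ} (G : Graph n) where
  open Graph G

  edge-≡ : (e f : Edge G) → proj₁ e ≡ proj₁ f → e ≡ f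
  edge-≡ ((p , q) , l , a) ((.p , .q) , l' , a') refl
    with <-irrelevant l l' | T-irrelevant a a'
  ... | refl | refl = refl

  Adj-irreflexive : ∀ x → ¬ Adj G x x
  Adj-irreflexive x a = subst T (loopless x) a

  Adj-sym : ∀ {x y} → Adj G x y → Adj G y x
  Adj-sym {x} {y} a = subst T (adj-sym x y) a

  edge-flip : ∀ {x y} (a : Adj G x y) (b : Adj G y x) → edge G a ≡ edge G b
  edge-flip {x} {y} a b with <-cmp x y | <-cmp y x
  ... | tri< lt _ _   | tri< lt' _ _  = ⊥-elim (<-asym lt lt')
  ... | tri< _ _ _    | tri≈ _ refl _ = ⊥-elim (Adj-irreflexive x a)
  ... | tri< _ _ _    | tri> _ _ _    = edge-≡ _ _ refl
  ... | tri≈ _ refl _ | _             = ⊥-elim (Adj-irreflexive x a)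
  ... | tri> _ _ _    | tri< _ _ _    = edge-≡ _ _ refl
  ... | tri> _ _ _    | tri≈ _ refl _ = ⊥-elim (Adj-irreflexive x a)
  ... | tri> _ _ gt   | tri> _ _ gt'  = ⊥-elim (<-asym gt gt')

  edge-irrelevant : ∀ {x y w} (a : Adj G x y) (b : Adj G x w) → y ≡ w → edge G a ≡ edge G b
  edge-irrelevant a b refl = cong (edge G) (T-irrelevant a b)

  Reach-trans : ∀ {φ x y z} → Reach G φ x y → Reach G φ y z → Reach G φ x z
  Reach-trans here r = r
  Reach-trans (step a a∉φ r) r' = step a a∉φ (Reach-trans r r')

  Reach-sym : ∀ {φ x y} → Reach G φ x y → Reach G φ y x
  Reach-sym here = here
  Reach-sym {φ} (step a a∉φ r) =
    Reach-trans (Reach-sym r)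
      (step (Adj-sym a) (λ p → a∉φ (subst φ (sym (edge-flip a (Adj-sym a))) p)) here)

  Reach-mono : ∀ {φ ψ : Edge G → Set} {x y} → (∀ f → ψ f → φ f) → Reach G φ x y → Reach G ψ x y
  Reach-mono ψ⊆φ here = here
  Reach-mono ψ⊆φ (step a a∉φ r) = step a (λ p → a∉φ (ψ⊆φ _ p)) (Reach-mono ψ⊆φ r)

  VR-sym : ∀ {R x x'} → VR G R x x' → VR G R x' x
  VR-sym x~x' e = Reach-sym (x~x' e)

module Squares {n : ℕ} (G : Graph n) (Q : EdgeRel G) (Q-equiv : IsEquivalence Q)
               (usp : UniqueSquareProperty G Q) where
  open GraphFacts G
  open IsEquivalence Q-equiv using () renaming (sym to Q-sym)

  Q-resp : ∀ {e e' f f'} → e ≡ e' → f ≡ f' → Q e f → Q e' f'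
  Q-resp refl refl q = q

  -- A square u v w y for the edges uv, uy is, seen from v, a square v u y w
  -- for the edges vu, vw.
  square-flip : ∀ {u v y w} (c : Adj G u v) (a : Adj G u y) → SquareWith G Q c a w →
                (c' : Adj G v u) (b : Adj G v w) → SquareWith G Q c' b y
  square-flip c a (s , uv~wy , uy~vw) c' b =
    record { xy = c' ; yw = a ; wz = Adj-sym wz ; zx = Adj-sym yw
           ; x≢w = y≢z ; y≢z = x≢w ; noChord-xw = noChord-yz ; noChord-yz = noChord-xw }
    , Q-resp (edge-flip c c') (edge-flip wz _) uv~wy
    , Q-sym (Q-resp refl (edge-irrelevant yw b refl) uy~vw)
    where open ChordlessSquare s

  module Transport (φ : Edge G → Set) (φ-closed : ∀ {e f} → Q e f → φ e → φ f) where

    -- The φ-edge from a vertex u to y arrives at v as the φ-edge v–target,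
    -- with y and target joined by a walk avoiding φ.
    record Translate (v y : Fin n) : Set where
      constructor translate
      field
        target  : Fin n
        arrow   : Adj G v target
        inClass : φ (edge G arrow)
        link    : Reach G φ y target
    open Translate public

    φ-closed⁻ : ∀ {e f} → Q e f → φ f → φ e
    φ-closed⁻ q = φ-closed (Q-sym q)

    module _ {u v} (c : Adj G u v) (c∉φ : ¬ φ (edge G c)) where

      -- The USP applies to uv ∉ φ and uy ∈ φ: they are distinct and not Q-related.
      squareAt : ∀ {y} (a : Adj G u y) → φ (edge G a) →
                 Σ (Fin n) λ w → SquareWith G Q c a w × (∀ w' → SquareWith G Q c a w' → w' ≡ w)
      squareAt {y} a a∈φ = usp c a v≢y (λ q → c∉φ (φ-closed⁻ q a∈φ))
        where
          v≢y : v ≢ y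
          v≢y refl = c∉φ (subst φ (edge-irrelevant a c refl) a∈φ)

      -- In a square u v w y with Q-related opposite sides, vw ∈ φ and wy ∉ φ.
      squareTranslate : ∀ {y w} (a : Adj G u y) → φ (edge G a) → SquareWith G Q c a w → Translate v y
      squareTranslate {w = w} a a∈φ (s , uv~wy , uy~vw) =
        translate w yw (φ-closed uy~vw a∈φ) (step (Adj-sym wz) yw∉φ here)
        where
          open ChordlessSquare s
          yw∉φ : ¬ φ (edge G (Adj-sym wz))
          yw∉φ p = c∉φ (φ-closed⁻ uv~wy (subst φ (sym (edge-flip wz (Adj-sym wz))) p))

      step-translate : ∀ {y} (a : Adj G u y) → φ (edge G a) → Translate v y
      step-translate a a∈φ = squareTranslate a a∈φ (proj₁ (proj₂ (squareAt a a∈φ)))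

      -- Both uy₁ and uy₂ give the unique square at v for vu and vw.
      step-injective : ∀ {y₁ y₂} (a₁ : Adj G u y₁) (p₁ : φ (edge G a₁))
                       (a₂ : Adj G u y₂) (p₂ : φ (edge G a₂)) →
                       target (step-translate a₁ p₁) ≡ target (step-translate a₂ p₂) → y₁ ≡ y₂
      step-injective a₁ p₁ a₂ p₂ eq = trans (unique _ square₁) (sym (unique _ square₂))
        where
          sq₁ = proj₁ (proj₂ (squareAt a₁ p₁))
          sq₂ = subst (SquareWith G Q c a₂) (sym eq) (proj₁ (proj₂ (squareAt a₂ p₂)))
          open ChordlessSquare (proj₁ sq₁)
          c' = Adj-sym c
          vu∉φ : ¬ φ (edge G c')
          vu∉φ p = c∉φ (subst φ (sym (edge-flip c c')) p)
          vw∈φ : φ (edge G yw)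
          vw∈φ = φ-closed (proj₂ (proj₂ sq₁)) p₁
          unique = proj₂ (proj₂ (usp c' yw x≢w (λ q → vu∉φ (φ-closed⁻ q vw∈φ))))
          square₁ = square-flip c a₁ sq₁ c' yw
          square₂ = square-flip c a₂ sq₂ c' yw

    transport : ∀ {u v} → Reach G φ u v → ∀ {y} (a : Adj G u y) → φ (edge G a) → Translate v y
    transport here {y} a a∈φ = translate y a a∈φ here
    transport (step c c∉φ W) a a∈φ =
      let t = step-translate c c∉φ a a∈φ
          t' = transport W (arrow t) (inClass t)
      in translate (target t') (arrow t') (inClass t') (Reach-trans (link t) (link t'))

    transport-injective : ∀ {u v} (W : Reach G φ u v) {y₁ y₂}
      (a₁ : Adj G u y₁) (p₁ : φ (edge G a₁)) (a₂ : Adj G u y₂) (p₂ : φ (edge G a₂)) →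
      target (transport W a₁ p₁) ≡ target (transport W a₂ p₂) → y₁ ≡ y₂
    transport-injective here a₁ p₁ a₂ p₂ eq = eq
    transport-injective (step c c∉φ W) a₁ p₁ a₂ p₂ eq =
      step-injective c c∉φ a₁ p₁ a₂ p₂
        (transport-injective W (arrow t₁) (inClass t₁) (arrow t₂) (inClass t₂) eq)
      where
        t₁ = step-translate c c∉φ a₁ p₁
        t₂ = step-translate c c∉φ a₂ p₂

module Counting where

  lookup-injective : ∀ {A : Set} {xs : List A} → Unique xs →
                     ∀ {i j} → lookup xs i ≡ lookup xs j → i ≡ j
  lookup-injective {xs = x ∷ xs} (x∉xs ∷ u) {zero}  {zero}  eq = refl
  lookup-injective {xs = x ∷ xs} (x∉xs ∷ u) {zero}  {suc j} eq = ⊥-elim (All.lookup x∉xs (∈-lookup j) eq)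
  lookup-injective {xs = x ∷ xs} (x∉xs ∷ u) {suc i} {zero}  eq = ⊥-elim (All.lookup x∉xs (∈-lookup i) (sym eq))
  lookup-injective {xs = x ∷ xs} (x∉xs ∷ u) {suc i} {suc j} eq = cong suc (lookup-injective u eq)

  unique-inject-≤ : ∀ {A B : Set} {xs : List A} {ys : List B} → Unique xs →
    (f : ∀ {x} → x ∈ xs → B) → (∀ {x} (m : x ∈ xs) → f m ∈ ys) →
    (∀ {x₁ x₂} (m₁ : x₁ ∈ xs) (m₂ : x₂ ∈ xs) → f m₁ ≡ f m₂ → x₁ ≡ x₂) →
    length xs ≤ length ys
  unique-inject-≤ {B = B} u f into f-injective = injective⇒≤ index-injective
    where
      index-injective : ∀ {i j} → Any.index (into (∈-lookup i)) ≡ Any.index (into (∈-lookup j)) → i ≡ j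
      index-injective eq = lookup-injective u (f-injective _ _
        (SetoidMembership.index-injective (setoid B) (into (∈-lookup _)) (into (∈-lookup _)) eq))

  count-mono : ∀ {n} {P P' : Fin n → Set} (d : Decidable P) (d' : Decidable P')
    (g : ∀ y → P y → Fin n) → (∀ y p → P' (g y p)) →
    (∀ y₁ y₂ p₁ p₂ → g y₁ p₁ ≡ g y₂ p₂ → y₁ ≡ y₂) → count d ≤ count d'
  count-mono {n} {P} d d' g g-into g-injective =
    unique-inject-≤ (filter⁺ d (allFin⁺ n)) image
      (λ m → ∈-filter⁺ d' (∈-allFin _) (g-into _ (member m)))
      (λ m₁ m₂ → g-injective _ _ (member m₁) (member m₂))
    where
      member : ∀ {y} → y ∈ filter d (allFin n) → P y
      member m = proj₂ (∈-filter⁻ d {xs = allFin n} m)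
      image : ∀ {y} → y ∈ filter d (allFin n) → Fin n
      image {y} m = g y (member m)

module FirstWitness {A : Set} where

  first : ∀ {P : A → Set} → Decidable P → (xs : List A) → Any P xs → Σ A P
  first d (x ∷ xs) any with d x
  ... | yes px = x , px
  first d (x ∷ xs) (here px)    | no ¬px = ⊥-elim (¬px px)
  first d (x ∷ xs) (there any)  | no _   = first d xs any

  first-cong : ∀ {P P' : A → Set} (d : Decidable P) (d' : Decidable P') → P ≐ P' →
    (xs : List A) (any : Any P xs) (any' : Any P' xs) → proj₁ (first d xs any) ≡ proj₁ (first d' xs any')
  first-cong d d' (P⊆P' , P'⊆P) (x ∷ xs) any any' with d x | d' x
  ... | yes _  | yes _   = refl
  ... | yes px | no ¬px' = ⊥-elim (¬px' (P⊆P' px))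
  ... | no ¬px | yes px' = ⊥-elim (¬px (P'⊆P px'))
  first-cong d d' P≐P' (x ∷ xs) (here px) _ | no ¬px | no _ = ⊥-elim (¬px px)
  first-cong d d' P≐P' (x ∷ xs) (there _) (here px') | no _ | no ¬px' = ⊥-elim (¬px' px')
  first-cong d d' P≐P' (x ∷ xs) (there any) (there any') | no _ | no _ = first-cong d d' P≐P' xs any any'

¬¬-∀-Fin : ∀ {m} {P : Fin m → Set} → (∀ i → ¬ ¬ P i) → ¬ ¬ (∀ i → P i)
¬¬-∀-Fin {ℕ.zero} h k = k (λ ())
¬¬-∀-Fin {ℕ.suc m} {P} h k =
  h zero λ p₀ → ¬¬-∀-Fin {m} {λ i → P (suc i)} (λ i → h (suc i))
    λ ps → k λ { zero → p₀ ; (suc i) → ps i }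

-- Every relation between edges is classically decidable: edges are determined
-- by their endpoints, so finitely many instances of excluded middle suffice.
¬¬-decidable : ∀ {n} (G : Graph n) (R : EdgeRel G) → ¬ ¬ (∀ e f → Dec (R e f))
¬¬-decidable {n} G R =
  ¬¬-map decideEdges
    (¬¬-∀-Fin λ p → ¬¬-∀-Fin λ q → ¬¬-∀-Fin λ p' → ¬¬-∀-Fin λ q' → ¬¬-excluded-middle)
  where
    open GraphFacts G
    AtEndpoints : Fin n → Fin n → Fin n → Fin n → Set
    AtEndpoints p q p' q' =
      Σ (Edge G) λ e → Σ (Edge G) λ f → proj₁ e ≡ (p , q) × proj₁ f ≡ (p' , q') × R e f
    decideEdges : (∀ p q p' q' → Dec (AtEndpoints p q p' q')) → ∀ e f → Dec (R e f)
    decideEdges dec e@((p , q) , _) f@((p' , q') , _) with dec p q p' q'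
    ... | yes (e₀ , f₀ , e₀≡ , f₀≡ , r) =
      yes (subst₂ R (edge-≡ e₀ e e₀≡) (edge-≡ f₀ f f₀≡) r)
    ... | no ¬r = no λ r → ¬r (e , f , refl , refl , r)

module Equitable {n : ℕ} (G : Graph n) (R : EdgeRel G) (R-equiv : IsEquivalence R)
                 (Q : EdgeRel G) (Q-equiv : IsEquivalence Q) (usp : UniqueSquareProperty G Q)
                 (Q⊆R : ∀ e f → Q e f → R e f) (R? : ∀ e f → Dec (R e f)) where
  open GraphFacts G
  open IsEquivalence R-equiv renaming (refl to R-refl; sym to R-sym; trans to R-trans)
  open FirstWitness

  -- Each R-class is a union of Q-classes, so edges can be transported along it.
  module Along (e₀ : Edge G) =
    Squares.Transport G Q Q-equiv usp (R e₀) (λ q r → R-trans r (Q⊆R _ _ q))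
  open Along using (target; arrow; inClass; link)

  SameClass : ∀ {x y} → Adj G x y → Fin n → Set
  SameClass {x} a j = Σ (Adj G x j) λ b → R (edge G b) (edge G a)

  sameClass? : ∀ {x y} (a : Adj G x y) → Decidable (SameClass a)
  sameClass? {x} a j with T? (Graph.adj G x j)
  ... | no ¬b = no λ c → ¬b (proj₁ c)
  ... | yes b with R? (edge G b) (edge G a)
  ...   | yes r = yes (b , r)
  ...   | no ¬r =
    no λ c → ¬r (subst (λ b' → R (edge G b') (edge G a)) (T-irrelevant (proj₁ c) b) (proj₂ c))

  representative : ∀ {x y} (a : Adj G x y) → Σ (Fin n) (SameClass a)
  representative {y = y} a =
    first (sameClass? a) (allFin n) (Any.map (λ { refl → a , R-refl }) (∈-allFin y))

  repEdge : ∀ {x y} → Adj G x y → Edge G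
  repEdge a = edge G (proj₁ (proj₂ (representative a)))

  repEdge∈class : ∀ {x y} (a : Adj G x y) → R (repEdge a) (edge G a)
  repEdge∈class a = proj₂ (proj₂ (representative a))

  repEdge-cong : ∀ {x y₁ y₂} (a₁ : Adj G x y₁) (a₂ : Adj G x y₂) →
                 R (edge G a₁) (edge G a₂) → repEdge a₁ ≡ repEdge a₂
  repEdge-cong a₁ a₂ r =
    edge-irrelevant (proj₁ (proj₂ (representative a₁))) (proj₁ (proj₂ (representative a₂)))
      (first-cong (sameClass? a₁) (sameClass? a₂)
        ((λ (b , s) → b , R-trans s r) , (λ (b , s) → b , R-trans s (R-sym r))) (allFin n) _ _)

  across : ∀ {x x' y} → VR G R x x' → (a : Adj G x y) → Along.Translate (repEdge a) x' y
  across x~x' a = Along.transport (repEdge a) (x~x' (repEdge a)) a (repEdge∈class a)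

  -- If xy and x'w lie in one R-class φ and y, w are joined avoiding φ, then
  -- y ∈ V_R(z) gives w ∈ V_R(z): a walk z–y–w avoids φ, and for any other
  -- class the walk z–y–x–x'–w avoids it.
  translate-in-VR : ∀ {x x' y w z e₀} → VR G R x x' → VR G R z y →
    (a : Adj G x y) → R e₀ (edge G a) → (b : Adj G x' w) → R e₀ (edge G b) →
    Reach G (R e₀) y w → VR G R z w
  translate-in-VR {e₀ = e₀} x~x' z~y a a∈φ b b∈φ y~w e with R? e (edge G b)
  ... | yes e~b =
    Reach-mono (λ f e~f → R-trans (R-trans b∈φ (R-sym e~b)) e~f) (Reach-trans (z~y e₀) y~w)
  ... | no e≁b =
    Reach-trans (z~y e) (step (Adj-sym a) yx∉φ (Reach-trans (x~x' e) (step b e≁b here)))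
    where
      yx∉φ : ¬ R e (edge G (Adj-sym a))
      yx∉φ p = e≁b (R-trans (subst (R e) (sym (edge-flip a (Adj-sym a))) p)
                             (R-trans (R-sym a∈φ) b∈φ))

  across-in-VR : ∀ {x x' y z} (x~x' : VR G R x x') → VR G R z y →
                 (a : Adj G x y) → VR G R z (target (across x~x' a))
  across-in-VR x~x' z~y a = translate-in-VR x~x' z~y a (repEdge∈class a)
    (arrow (across x~x' a)) (inClass (across x~x' a)) (link (across x~x' a))

  -- Equal targets force equal classes, hence the same walk, hence equal sources.
  across-injective : ∀ {x x' y₁ y₂} (x~x' : VR G R x x') (a₁ : Adj G x y₁) (a₂ : Adj G x y₂) →
    target (across x~x' a₁) ≡ target (across x~x' a₂) → y₁ ≡ y₂
  across-injective {y₁ = y₁} {y₂} x~x' a₁ a₂ eq =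
    sameWalk (repEdge-cong a₁ a₂ sameClass) (repEdge∈class a₁) (repEdge∈class a₂) eq
    where
      t₁ = across x~x' a₁
      t₂ = across x~x' a₂
      sameClass : R (edge G a₁) (edge G a₂)
      sameClass = R-trans (R-trans (R-sym (repEdge∈class a₁)) (inClass t₁))
        (subst (λ f → R f (edge G a₂)) (edge-irrelevant (arrow t₂) (arrow t₁) (sym eq))
          (R-trans (R-sym (inClass t₂)) (repEdge∈class a₂)))
      sameWalk : ∀ {e₁ e₂} → e₁ ≡ e₂ → (p₁ : R e₁ (edge G a₁)) (p₂ : R e₂ (edge G a₂)) →
        target (Along.transport e₁ (x~x' e₁) a₁ p₁) ≡ target (Along.transport e₂ (x~x' e₂) a₂ p₂) →
        y₁ ≡ y₂
      sameWalk {e₁} refl p₁ p₂ = Along.transport-injective e₁ (x~x' e₁) a₁ p₁ a₂ p₂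

  neighbours-≤ : ∀ {x x' z} → VR G R x x' →
    (d : Decidable (λ y → Adj G x y × VR G R z y)) →
    (d' : Decidable (λ y → Adj G x' y × VR G R z y)) →
    count d ≤ count d'
  neighbours-≤ x~x' d d' = Counting.count-mono d d'
    (λ _ (a , _) → target (across x~x' a))
    (λ _ (a , z~y) → arrow (across x~x' a) , across-in-VR x~x' z~y a)
    (λ _ _ (a₁ , _) (a₂ , _) → across-injective x~x' a₁ a₂)

mainTheorem1 : ∀ {n} (G : Graph n) → Connected G →
    (R : EdgeRel G) → IsEquivalence R → IsUSPRelation G R →
    ∀ (x x' z : Fin n) → VR G R x x' →
    (d : Decidable (λ y → Adj G x y × VR G R z y)) →
    (d' : Decidable (λ y → Adj G x' y × VR G R z y)) →
    count d ≡ count d'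
mainTheorem1 G _ R R-equiv (Q , Q-equiv , usp , Q⊆R) x x' z x~x' d d' =
  ≤-antisym (bound x~x' d d') (bound (GraphFacts.VR-sym G x~x') d' d)
  where
    -- The inequality is decidable, so R may be assumed decidable.
    bound : ∀ {u v} → VR G R u v → (du : Decidable (λ y → Adj G u y × VR G R z y)) →
            (dv : Decidable (λ y → Adj G v y × VR G R z y)) → count du ≤ count dv
    bound u~v du dv = decidable-stable (count du ≤? count dv) λ ≰ →
      ¬¬-decidable G R λ R? →
        ≰ (Equitable.neighbours-≤ G R R-equiv Q Q-equiv usp Q⊆R R? u~v du dv)
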